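{- For all natural numbers $F,G,H\ge2$, we have $2^{H^{G^F}-H}>G^{FH^G}$. -}

module Submission where

-- Write G = 1 + g and X = H ^ G.  Since G ≤ 2 ^ g, the left-hand side is at
-- most 2 ^ (g * (F * X)), so it suffices to bound the exponent:
--
--   g * F * X + H  <  g * F * X + X  =  (g * F + 1) * X
--                  ≤  X ^ (F - 1) * X  =  H ^ (G * F)  ≤  H ^ (G ^ F).
--
-- Every step is an instance of the elementary growth fact  k < b ^ k  for
-- b ≥ 2 (and its consequence  b * k ≤ b ^ k ): it gives  G ≤ 2 ^ g,  H < X,
-- the coefficient bound  g * F + 1 ≤ X ^ (F - 1)  (via  2 * G ≤ X),  and
-- G * F ≤ G ^ F.

open import Data.Nat using (ℕ; _+_; _*_; _∸_; _^_; _≤_; _<_; _>_; zero; suc; z≤n; s≤s; s≤s⁻¹)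
open import Data.Nat.Properties
open import Data.Nat.Tactic.RingSolver using (solve-∀)
open import Relation.Binary.PropositionalEquality using (_≡_; cong; sym)

open ≤-Reasoning

k<b^k : ∀ {b} → 2 ≤ b → ∀ k → k < b ^ k
k<b^k 2≤b zero    = s≤s z≤n
k<b^k {b} 2≤b (suc k) = begin
  2 + k          ≤⟨ s≤s (m≤n+m (suc k) k) ⟩
  suc k + suc k  ≡⟨ cong (suc k +_) (*-identityˡ (suc k)) ⟨
  2 * suc k      ≤⟨ *-mono-≤ 2≤b (k<b^k 2≤b k) ⟩
  b * b ^ k      ∎

b*k≤b^k : ∀ {b} → 2 ≤ b → ∀ k → b * k ≤ b ^ k
b*k≤b^k {b} 2≤b zero    = ≤-trans (≤-reflexive (*-zeroʳ b)) z≤n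
b*k≤b^k {b} 2≤b (suc k) = *-monoʳ-≤ b (k<b^k 2≤b k)

[1+g]^e≤2^[g*e] : ∀ g e → suc g ^ e ≤ 2 ^ (g * e)
[1+g]^e≤2^[g*e] g e = begin
  suc g ^ e    ≤⟨ ^-monoˡ-≤ e (k<b^k ≤-refl g) ⟩
  (2 ^ g) ^ e  ≡⟨ ^-*-assoc 2 g e ⟩
  2 ^ (g * e)  ∎

b<b^k : ∀ {b k} → 2 ≤ b → 2 ≤ k → b < b ^ k
b<b^k {b@(suc _)} {suc k} 2≤b (s≤s 1≤k) = m<m*n b (b ^ k) 1<b^k
  where
  1<b^k : 1 < b ^ k
  1<b^k = ≤-trans 2≤b (≤-trans (≤-reflexive (sym (*-identityʳ b))) (^-monoʳ-≤ b 1≤k))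

coefficient≤ : ∀ {X} g f → 2 * suc g ≤ X → g * (2 + f) + 1 ≤ X ^ suc f
coefficient≤ {X} g f 2G≤X = begin
  g * (2 + f) + 1                         ≤⟨ m≤m+n _ (g * f + 2 * f + 1) ⟩
  g * (2 + f) + 1 + (g * f + 2 * f + 1)   ≡⟨ expand g f ⟩
  2 * suc g * suc f                       ≤⟨ *-mono-≤ 2G≤X (k<b^k 2≤X f) ⟩
  X * X ^ f                               ∎
  where
  2≤X : 2 ≤ X
  2≤X = ≤-trans (*-monoʳ-≤ 2 (s≤s z≤n)) 2G≤X
  expand : ∀ g f → g * (2 + f) + 1 + (g * f + 2 * f + 1) ≡ 2 * suc g * suc f
  expand = solve-∀

exponent-bound : ∀ {F H} g → 2 ≤ F → 1 ≤ g → 2 ≤ H →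
  suc (g * (F * H ^ suc g)) + H ≤ H ^ (suc g ^ F)
exponent-bound {suc (suc f)} {H@(suc _)} g (s≤s (s≤s _)) 1≤g 2≤H@(s≤s _) = begin
  suc (g * (F * X)) + H   ≡⟨ +-suc (g * (F * X)) H ⟨
  g * (F * X) + suc H     ≤⟨ +-monoʳ-≤ (g * (F * X)) (b<b^k 2≤H 2≤G) ⟩
  g * (F * X) + X         ≡⟨ factor g F X ⟩
  (g * F + 1) * X         ≤⟨ *-monoˡ-≤ X (coefficient≤ g f 2G≤X) ⟩
  X ^ suc f * X           ≡⟨ *-comm (X ^ suc f) X ⟩
  X ^ F                   ≡⟨ ^-*-assoc H G F ⟩
  H ^ (G * F)             ≤⟨ ^-monoʳ-≤ H (b*k≤b^k 2≤G F) ⟩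
  H ^ (G ^ F)             ∎
  where
  F G X : ℕ
  F = suc (suc f)
  G = suc g
  X = H ^ G
  2≤G : 2 ≤ G
  2≤G = s≤s 1≤g
  2G≤X : 2 * G ≤ X
  2G≤X = ≤-trans (b*k≤b^k ≤-refl G) (^-monoˡ-≤ G 2≤H)
  factor : ∀ g F X → g * (F * X) + X ≡ (g * F + 1) * X
  factor = solve-∀

lemma11 : ∀ (F G H : ℕ) → 2 ≤ F → 2 ≤ G → 2 ≤ H →
    2 ^ (H ^ (G ^ F) ∸ H) > G ^ (F * H ^ G)
lemma11 F zero    H 2≤F () 2≤H
lemma11 F (suc g) H 2≤F 2≤G 2≤H = begin-strict
  suc g ^ (F * H ^ suc g)    ≤⟨ [1+g]^e≤2^[g*e] g (F * H ^ suc g) ⟩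
  2 ^ (g * (F * H ^ suc g))  <⟨ ^-monoʳ-< 2 ≤-refl exponent<gap ⟩
  2 ^ (H ^ (suc g ^ F) ∸ H)  ∎
  where
  exponent<gap : g * (F * H ^ suc g) < H ^ (suc g ^ F) ∸ H
  exponent<gap = m+n≤o⇒m≤o∸n _ (exponent-bound g 2≤F (s≤s⁻¹ 2≤G) 2≤H)
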